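{- For every integer $n\ge1$, $\sigma(n)\le 3n-3$; i.e., for every string of length $n$ the sum of the exponents of all its runs is at most $3n-3$.
   Context: Strings are indexed from 1. An integer $p\ge1$ is a period of $s$ if $s[k]=s[k+p]$ for all $1\le k\le |s|-p$. A run of a string $w$ of length $n$ is a triple $(i,j,p)$ with $1\le i\le j\le n$ such that $p$ is the smallest period of $w[i..j]$, $j-i+1\ge 2p$, ($i=1$ or $w[i-1]\ne w[i+p-1]$), and ($j=n$ or $w[j+1]\ne w[j-p+1]$). Its exponent is $(j-i+1)/p$. $\sigma(n)$ denotes the maximum, over strings of length $n$, of the sum of exponents of all runs of the string. -}

module Defs where

open import Data.Nat using (ℕ; zero; suc; _+_; _*_; _∸_; _≤_; _<_)
open import Data.Integer using (+_)
open import Data.Rational using (ℚ; _/_; 0ℚ) renaming (_+_ to _+ℚ_)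
open import Data.Product using (_×_; _,_)
open import Data.Sum using (_⊎_)
open import Data.List using (List; []; _∷_)
open import Relation.Binary.PropositionalEquality using (_≡_; _≢_)
open import Relation.Nullary using (¬_)

-- A string of length n over alphabet A is represented by w : ℕ → A,
-- where only the letters w 1 , … , w n (1-indexed) are meaningful.

HasPeriod : {A : Set} → (ℕ → A) → ℕ → ℕ → ℕ → Set
HasPeriod w i j p = ∀ k → i ≤ k → k + p ≤ j → w k ≡ w (k + p)

SmallestPeriod : {A : Set} → (ℕ → A) → ℕ → ℕ → ℕ → Set
SmallestPeriod w i j p =
  1 ≤ p × HasPeriod w i j p × (∀ q → 1 ≤ q → q < p → ¬ HasPeriod w i j q)

IsRun : {A : Set} → ℕ → (ℕ → A) → ℕ × ℕ × ℕ → Set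
IsRun n w (i , j , p) =
  1 ≤ i × i ≤ j × j ≤ n
  × SmallestPeriod w i j p
  × 2 * p ≤ suc j ∸ i
  × (i ≡ 1 ⊎ w (i ∸ 1) ≢ w (i + p ∸ 1))
  × (j ≡ n ⊎ w (suc j) ≢ w (suc j ∸ p))

exponent : ℕ × ℕ × ℕ → ℚ
exponent (i , j , zero) = 0ℚ
exponent (i , j , suc q) = (+ (suc j ∸ i)) / suc q

sumℚ : List ℚ → ℚ
sumℚ [] = 0ℚ
sumℚ (x ∷ xs) = x +ℚ sumℚ xs

-- Read letters as naturals and, for a run (i, j, p), use whichever of < and > makes the letter w[j+1]
-- after the run smaller than w[j+1-p].  As p is the least period, the least rotation of the period in
-- that order is a Lyndon word, the Lyndon root, and a copy of it starts at ⌊e⌋ - 1 positions x > i of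
-- the run, e its exponent.  No x is such a start for two runs.  Indeed w[x-1] = w[x+p-1], so p = 1 or
-- w[x] is smaller than w[x-1] in the run's order; hence two runs with roots at x use the same order
-- unless one has period 1, which is then impossible.  A root at x longer than the shorter period
-- would, in the run with that period, reach past its end and compare w[j+1] with w[j+1-p] the wrong
-- way; and runs of equal period sharing p + 1 consecutive letters coincide.  The starts lie in 2 … n,
-- so the ⌊e⌋ - 1 sum to at most n - 1, and e < ⌊e⌋ + 1 ≤ 3 (⌊e⌋ - 1) as ⌊e⌋ ≥ 2.

module Submission where

open import Defs
open import Data.Bool using (Bool; true; false)
open import Data.Empty using (⊥; ⊥-elim)
open import Data.Integer as ℤ using (+≤+)
import Data.Integer.Properties as ℤ
open import Data.List using (List; []; _∷_; map)
import Data.List.Relation.Unary.All as All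
open import Data.List.Relation.Unary.All using (All; []; _∷_)
open import Data.List.Relation.Unary.AllPairs using ([]; _∷_)
open import Data.List.Relation.Unary.Unique.Propositional using (Unique)
import Data.Nat as ℕ
open import Data.Nat
  using (ℕ; zero; suc; _+_; _*_; _∸_; _%_; _≤_; _<_; _≤?_; _<?_; _≟_; z≤n; s≤s; s≤s⁻¹; NonZero)
open import Data.Nat.DivMod
  using (m≡m%n+[m/n]*n; m%n<n; [m+n]%n≡m%n; [m+kn]%n≡m%n; m<n⇒m%n≡m; n%n≡0; m/n*n≤m; m*n/n≡m; /-mono-≤)
open import Data.Nat.ListAction using (sum)
open import Data.Nat.Properties
open import Algebra.Properties.CommutativeSemigroup +-commutativeSemigroup
  using (xy∙z≈xz∙y; x∙yz≈xz∙y; interchange)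
open import Data.Nat.Tactic.RingSolver using (solve-∀)
open import Data.Product using (∃-syntax; _×_; _,_; proj₁; proj₂)
open import Data.Rational using (ℚ; _/_; toℚᵘ) renaming (_≤_ to _≤ℚ_; _+_ to _+ℚ_)
import Data.Rational.Properties as ℚ
open import Data.Rational.Unnormalised using (mkℚᵘ; *≤*; *≡*) renaming (_+_ to _+ᵘ_; _≃_ to _≃ᵘ_)
import Data.Rational.Unnormalised.Properties as ℚᵘ
open import Data.Sum using (_⊎_; inj₁; inj₂; [_,_]; map₂)
open import Relation.Binary.Definitions using (tri<; tri≈; tri>)
open import Relation.Binary.PropositionalEquality
  using (_≡_; _≢_; refl; sym; trans; cong; cong₂; subst; subst₂; module ≡-Reasoning)
open import Relation.Nullary using (¬_; Dec; yes; no)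
open import Relation.Nullary.Decidable using (decidable-stable; _×-dec_; _⊎-dec_; map′)
open import Relation.Nullary.Decidable.Core using (¬¬-excluded-middle)

_<[_]_ : ℕ → Bool → ℕ → Set
a <[ true  ] b = a < b
a <[ false ] b = b < a

<[]-irrefl : ∀ d {a} → ¬ a <[ d ] a
<[]-irrefl true  = <-irrefl refl
<[]-irrefl false = <-irrefl refl

<[]-trans : ∀ d {a b c} → a <[ d ] b → b <[ d ] c → a <[ d ] c
<[]-trans true  a<b b<c = <-trans a<b b<c
<[]-trans false b<a c<b = <-trans c<b b<a

<[]-asym : ∀ d {a b} → a <[ d ] b → ¬ b <[ d ] a
<[]-asym d a<b b<a = <[]-irrefl d (<[]-trans d a<b b<a)

<[]-cmp : ∀ d a b → a <[ d ] b ⊎ b <[ d ] a ⊎ a ≡ b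
<[]-cmp true a b with <-cmp a b
... | tri< a<b _ _ = inj₁ a<b
... | tri≈ _ a≡b _ = inj₂ (inj₂ a≡b)
... | tri> _ _ b<a = inj₂ (inj₁ b<a)
<[]-cmp false a b with <-cmp a b
... | tri< a<b _ _ = inj₂ (inj₁ a<b)
... | tri≈ _ a≡b _ = inj₂ (inj₂ a≡b)
... | tri> _ _ b<a = inj₁ b<a

<[]-direction-unique : ∀ d d′ {a b} → a <[ d ] b → a <[ d′ ] b → d ≡ d′
<[]-direction-unique true  true  _   _   = refl
<[]-direction-unique false false _   _   = refl
<[]-direction-unique true  false a<b b<a = ⊥-elim (<-asym a<b b<a)
<[]-direction-unique false true  b<a a<b = ⊥-elim (<-asym a<b b<a)

directionOf : ℕ → ℕ → Bool
directionOf a b with a <? b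
... | yes _ = true
... | no  _ = false

directionOf-< : ∀ {a b} → a ≢ b → a <[ directionOf a b ] b
directionOf-< {a} {b} a≢b with a <? b
... | yes a<b = a<b
... | no  a≮b = ≤∧≢⇒< (≮⇒≥ a≮b) (λ b≡a → a≢b (sym b≡a))

Agree : ℕ → (ℕ → ℕ) → (ℕ → ℕ) → Set
Agree m g h = ∀ s → s < m → g s ≡ h s

Agree-sym : ∀ {m g h} → Agree m g h → Agree m h g
Agree-sym g≗h s s<m = sym (g≗h s s<m)

Agree-trans : ∀ {m g h k} → Agree m g h → Agree m h k → Agree m g k
Agree-trans g≗h h≗k s s<m = trans (g≗h s s<m) (h≗k s s<m)

Agree-shrink : ∀ {m m′ g h} → m′ ≤ m → Agree m g h → Agree m′ g h
Agree-shrink m′≤m g≗h s s<m′ = g≗h s (<-≤-trans s<m′ m′≤m)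

Agree-snoc : ∀ {m g h} → Agree m g h → g m ≡ h m → Agree (suc m) g h
Agree-snoc g≗h gm≡hm s s<1+m with m<1+n⇒m<n∨m≡n s<1+m
... | inj₁ s<m = g≗h s s<m
... | inj₂ refl = gm≡hm

record LexLess (d : Bool) (m : ℕ) (g h : ℕ → ℕ) : Set where
  constructor lexLess
  field
    index       : ℕ
    index<m     : index < m
    agreeBefore : Agree index g h
    differ      : g index <[ d ] h index

LexLess-extend : ∀ {d m m′ g h} → m ≤ m′ → LexLess d m g h → LexLess d m′ g h
LexLess-extend m≤m′ (lexLess t t<m agree lt) = lexLess t (<-≤-trans t<m m≤m′) agree lt

lex-cmp : ∀ d m g h → LexLess d m g h ⊎ LexLess d m h g ⊎ Agree m g h
lex-cmp d zero    g h = inj₂ (inj₂ λ _ ())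
lex-cmp d (suc m) g h with lex-cmp d m g h
... | inj₁ g<h        = inj₁ (LexLess-extend (n≤1+n m) g<h)
... | inj₂ (inj₁ h<g) = inj₂ (inj₁ (LexLess-extend (n≤1+n m) h<g))
... | inj₂ (inj₂ g≗h) with <[]-cmp d (g m) (h m)
...   | inj₁ gm<hm        = inj₁ (lexLess m ≤-refl g≗h gm<hm)
...   | inj₂ (inj₁ hm<gm) = inj₂ (inj₁ (lexLess m ≤-refl (Agree-sym g≗h) hm<gm))
...   | inj₂ (inj₂ gm≡hm) = inj₂ (inj₂ (Agree-snoc g≗h gm≡hm))

lex-agree-⊥ : ∀ {d m g h} → LexLess d m g h → ¬ Agree m g h
lex-agree-⊥ {d} {h = h} (lexLess t t<m _ lt) g≗h =
  <[]-irrefl d (subst (λ z → z <[ d ] h t) (g≗h t t<m) lt)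

lex-irrefl : ∀ {d m g} → ¬ LexLess d m g g
lex-irrefl g<g = lex-agree-⊥ g<g (λ _ _ → refl)

lex-trans : ∀ {d m g h k} → LexLess d m g h → LexLess d m h k → LexLess d m g k
lex-trans {d} {g = g} {k = k} (lexLess t₁ t₁<m agree₁ lt₁) (lexLess t₂ t₂<m agree₂ lt₂)
  with <-cmp t₁ t₂
... | tri< t₁<t₂ _ _ = lexLess t₁ t₁<m (Agree-trans agree₁ (Agree-shrink (<⇒≤ t₁<t₂) agree₂))
                         (subst (λ z → g t₁ <[ d ] z) (agree₂ t₁ t₁<t₂) lt₁)
... | tri≈ _ refl _  = lexLess t₁ t₁<m (Agree-trans agree₁ agree₂) (<[]-trans d lt₁ lt₂)
... | tri> _ _ t₂<t₁ = lexLess t₂ t₂<m (Agree-trans (Agree-shrink (<⇒≤ t₂<t₁) agree₁) agree₂)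
                         (subst (λ z → z <[ d ] k t₂) (sym (agree₁ t₂ t₂<t₁)) lt₂)

lex-asym : ∀ {d m g h} → LexLess d m g h → ¬ LexLess d m h g
lex-asym g<h h<g = lex-irrefl (lex-trans g<h h<g)

lex-congˡ : ∀ {d m g g′ h} → (∀ s → g s ≡ g′ s) → LexLess d m g h → LexLess d m g′ h
lex-congˡ {d} {h = h} g≗g′ (lexLess t t<m agree lt) =
  lexLess t t<m (λ s s<t → trans (sym (g≗g′ s)) (agree s s<t)) (subst (λ z → z <[ d ] h t) (g≗g′ t) lt)

lex-minimum : ∀ d m (R : ℕ → ℕ → ℕ) k → ∃[ b ] b ≤ k × ∀ u → u ≤ k → ¬ LexLess d m (R u) (R b)
lex-minimum d m R zero = 0 , z≤n , λ { _ z≤n → lex-irrefl }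
lex-minimum d m R (suc k) with lex-minimum d m R k
... | b , b≤k , b-least with lex-cmp d m (R (suc k)) (R b)
...   | inj₁ new<b = suc k , ≤-refl , new-least
  where
  new-least : ∀ u → u ≤ suc k → ¬ LexLess d m (R u) (R (suc k))
  new-least u u≤1+k u<new with m≤n⇒m<n∨m≡n u≤1+k
  ... | inj₁ u<1+k = b-least u (s≤s⁻¹ u<1+k) (lex-trans u<new new<b)
  ... | inj₂ refl  = lex-irrefl u<new
...   | inj₂ b≤new = b , m≤n⇒m≤1+n b≤k , b-still-least
  where
  b-still-least : ∀ u → u ≤ suc k → ¬ LexLess d m (R u) (R b)
  b-still-least u u≤1+k u<b with m≤n⇒m<n∨m≡n u≤1+k
  ... | inj₁ u<1+k = b-least u (s≤s⁻¹ u<1+k) u<b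
  ... | inj₂ refl  = [ lex-asym u<b , lex-agree-⊥ u<b ] b≤new

<∸⇒+< : ∀ {s m e} → s < m ∸ e → e + s < m
<∸⇒+< {s} {m} {e} s<m∸e = subst (_< m) (+-comm s e) (m≤o∸n⇒m+n≤o (suc s) e≤m s<m∸e)
  where
  e≤m : e ≤ m
  e≤m = <⇒≤ (m∸n≢0⇒n<m λ m∸e≡0 → <⇒≱ s<m∸e (subst (_≤ s) (sym m∸e≡0) z≤n))

-- w[a..a+ℓ], a factor of length ℓ + 1, is smaller than each of its proper suffixes
IsLyndon : Bool → (ℕ → ℕ) → ℕ → ℕ → Set
IsLyndon d w a ℓ =
  ∀ e → 0 < e → e ≤ ℓ → LexLess d (suc ℓ ∸ e) (λ s → w (a + s)) (λ s → w (a + e + s))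

IsLyndon-transport : ∀ {d v w a b ℓ} → (∀ s → s ≤ ℓ → w (a + s) ≡ v (b + s)) →
                     IsLyndon d v b ℓ → IsLyndon d w a ℓ
IsLyndon-transport {d} {v} {w} {a} {b} {ℓ} w≗v lyndon e 0<e e≤ℓ with lyndon e 0<e e≤ℓ
... | lexLess t t<ℓ′ agree lt = lexLess t t<ℓ′ agree′ (subst₂ _<[ d ]_ (sym (prefix t t<ℓ′)) (sym (suffix t t<ℓ′)) lt)
  where
  prefix : ∀ s → s < suc ℓ ∸ e → w (a + s) ≡ v (b + s)
  prefix s s<ℓ′ = w≗v s (≤-trans (m≤n+m s e) (s≤s⁻¹ (<∸⇒+< s<ℓ′)))
  suffix : ∀ s → s < suc ℓ ∸ e → w (a + e + s) ≡ v (b + e + s)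
  suffix s s<ℓ′ = begin
    w (a + e + s)   ≡⟨ cong w (+-assoc a e s) ⟩
    w (a + (e + s)) ≡⟨ w≗v (e + s) (s≤s⁻¹ (<∸⇒+< s<ℓ′)) ⟩
    v (b + (e + s)) ≡⟨ cong v (sym (+-assoc b e s)) ⟩
    v (b + e + s)   ∎
    where open ≡-Reasoning
  agree′ : Agree t (λ s → w (a + s)) (λ s → w (a + e + s))
  agree′ s s<t = trans (prefix s s<ℓ′) (trans (agree s s<t) (sym (suffix s s<ℓ′)))
    where s<ℓ′ = <-trans s<t t<ℓ′

IsLyndon⇒first<last : ∀ {d w a ℓ} → 0 < ℓ → IsLyndon d w a ℓ → w a <[ d ] w (a + ℓ)
IsLyndon⇒first<last {d} {w} {a} {ℓ} 0<ℓ lyndon with lyndon ℓ 0<ℓ ≤-refl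
... | lexLess t t<1 _ lt with n<1⇒n≡0 (subst (t <_) (m+n∸n≡m 1 ℓ) t<1)
...   | refl = subst₂ _<[ d ]_ (cong w (+-identityʳ a)) (cong w (+-identityʳ (a + ℓ))) lt

module LeastRotation (f : ℕ → ℕ) (q : ℕ) (f-periodic : ∀ x → f (x + suc q) ≡ f x) (d : Bool) where

  P : ℕ
  P = suc q

  rotation : ℕ → ℕ → ℕ
  rotation u s = f (u + s)

  f-periodic-* : ∀ x k → f (x + k * P) ≡ f x
  f-periodic-* x zero    = cong f (+-identityʳ x)
  f-periodic-* x (suc k) = begin
    f (x + (P + k * P)) ≡⟨ cong f (sym (+-assoc x P (k * P))) ⟩
    f (x + P + k * P)   ≡⟨ f-periodic-* (x + P) k ⟩
    f (x + P)           ≡⟨ f-periodic x ⟩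
    f x                 ∎
    where open ≡-Reasoning

  f-modʳ : ∀ a z → f (a + z) ≡ f (a + z % P)
  f-modʳ a z = begin
    f (a + z)                      ≡⟨ cong (λ y → f (a + y)) (m≡m%n+[m/n]*n z P) ⟩
    f (a + (z % P + z ℕ./ P * P))  ≡⟨ cong f (sym (+-assoc a (z % P) _)) ⟩
    f (a + z % P + z ℕ./ P * P)    ≡⟨ f-periodic-* (a + z % P) (z ℕ./ P) ⟩
    f (a + z % P)                  ∎
    where open ≡-Reasoning

  f-modˡ : ∀ z a → f (z + a) ≡ f (z % P + a)
  f-modˡ z a = trans (cong f (+-comm z a)) (trans (f-modʳ a z) (cong f (+-comm a (z % P))))

  leastRotation : ℕ
  leastRotation = proj₁ (lex-minimum d P rotation q)

  private
    b = leastRotation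

  leastRotation≤q : b ≤ q
  leastRotation≤q = proj₁ (proj₂ (lex-minimum d P rotation q))

  leastRotation-minimal : ∀ u → ¬ LexLess d P (rotation u) (rotation b)
  leastRotation-minimal u u<b = proj₂ (proj₂ (lex-minimum d P rotation q)) (u % P) (m<1+n⇒m≤n (m%n<n u P))
    (lex-congˡ (f-modˡ u) u<b)

  agree⇒shift : ∀ e → Agree P (rotation b) (rotation (b + e)) → ∀ y → f y ≡ f (y + e)
  agree⇒shift e agree y = begin
    f y                ≡⟨ sym (f-periodic-* y b) ⟩
    f (y + b * P)      ≡⟨ cong f (shift-in y b q) ⟩
    f (b + z)          ≡⟨ f-modʳ b z ⟩
    f (b + z % P)      ≡⟨ agree (z % P) (m%n<n z P) ⟩
    f (b + e + z % P)  ≡⟨ sym (f-modʳ (b + e) z) ⟩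
    f (b + e + z)      ≡⟨ cong f (shift-out b e y q) ⟩
    f (y + e + b * P)  ≡⟨ f-periodic-* (y + e) b ⟩
    f (y + e)          ∎
    where
    open ≡-Reasoning
    z = y + b * q
    shift-in : ∀ y b q → y + b * suc q ≡ b + (y + b * q)
    shift-in = solve-∀
    shift-out : ∀ b e y q → b + e + (y + b * q) ≡ y + e + b * suc q
    shift-out = solve-∀

  -- The first difference of the two rotations lies beyond P ∸ e, where rotation b has wrapped around
  -- and is compared with rotation (b + (P ∸ e)).
  conjugate-smaller : ∀ {e} → e ≤ P → Agree (P ∸ e) (rotation b) (rotation (b + e)) →
                      LexLess d P (rotation b) (rotation (b + e)) → LexLess d P (rotation (b + (P ∸ e))) (rotation b)
  conjugate-smaller {e} e≤P agree-short (lexLess t t<P agree lt) with t <? P ∸ e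
  ... | yes t<m = ⊥-elim (lex-agree-⊥ (lexLess t t<m agree lt) agree-short)
  ... | no  t≮m = lexLess (t ∸ m) (≤-<-trans (m∸n≤m t m) t<P) agree′ lt′
    where
    m = P ∸ e
    m+t′≡t : m + (t ∸ m) ≡ t
    m+t′≡t = m+[n∸m]≡n (≮⇒≥ t≮m)
    wraps : ∀ s → f (b + e + (m + s)) ≡ f (b + s)
    wraps s = trans (cong f (trans (regroup b e m s) (cong (_+_ (b + s)) (m+[n∸m]≡n e≤P)))) (f-periodic (b + s))
      where
      regroup : ∀ b e m s → b + e + (m + s) ≡ b + s + (e + m)
      regroup = solve-∀
    agree′ : Agree (t ∸ m) (rotation (b + m)) (rotation b)
    agree′ s s<t′ = trans (cong f (+-assoc b m s))
      (trans (agree (m + s) (subst (m + s <_) m+t′≡t (+-monoʳ-< m s<t′))) (wraps s))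
    lt′ : f (b + m + (t ∸ m)) <[ d ] f (b + (t ∸ m))
    lt′ = subst₂ _<[ d ]_
      (trans (cong (λ y → f (b + y)) (sym m+t′≡t)) (cong f (sym (+-assoc b m (t ∸ m)))))
      (trans (cong (λ y → f (b + e + y)) (sym m+t′≡t)) (wraps (t ∸ m))) lt

  Primitive : Set
  Primitive = ∀ e → 0 < e → e < P → ¬ (∀ y → f y ≡ f (y + e))

  leastRotation-isLyndon : Primitive → IsLyndon d f b q
  leastRotation-isLyndon f-primitive e 0<e e≤q with lex-cmp d (P ∸ e) (rotation b) (rotation (b + e))
  ... | inj₁ b<b+e        = b<b+e
  ... | inj₂ (inj₁ b+e<b) = ⊥-elim (leastRotation-minimal (b + e) (LexLess-extend (m∸n≤m P e) b+e<b))
  ... | inj₂ (inj₂ agree-short) with lex-cmp d P (rotation b) (rotation (b + e))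
  ...   | inj₁ b<b+e        = ⊥-elim (leastRotation-minimal (b + (P ∸ e)) (conjugate-smaller (m≤n⇒m≤1+n e≤q) agree-short b<b+e))
  ...   | inj₂ (inj₁ b+e<b) = ⊥-elim (leastRotation-minimal (b + e) b+e<b)
  ...   | inj₂ (inj₂ agree) = ⊥-elim (f-primitive e 0<e (s≤s e≤q) (agree⇒shift e agree))

indicator : {P : Set} → Dec P → ℕ
indicator (yes _) = 1
indicator (no  _) = 0

indicator-yes : ∀ {P : Set} (p? : Dec P) → P → indicator p? ≡ 1
indicator-yes (yes _) _ = refl
indicator-yes (no ¬p) p = ⊥-elim (¬p p)

indicator-no : ∀ {P : Set} (p? : Dec P) → ¬ P → indicator p? ≡ 0
indicator-no (yes p) ¬p = ⊥-elim (¬p p)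
indicator-no (no  _) _  = refl

sumBelow : ℕ → (ℕ → ℕ) → ℕ
sumBelow zero    g = 0
sumBelow (suc N) g = sumBelow N g + g N

sumBelow-+ : ∀ N g h → sumBelow N (λ x → g x + h x) ≡ sumBelow N g + sumBelow N h
sumBelow-+ zero    g h = refl
sumBelow-+ (suc N) g h =
  trans (cong (_+ (g N + h N)) (sumBelow-+ N g h)) (interchange (sumBelow N g) (sumBelow N h) (g N) (h N))

sumBelow-zeros : ∀ {g} N → (∀ x → x < N → g x ≡ 0) → sumBelow N g ≡ 0
sumBelow-zeros zero    _   = refl
sumBelow-zeros (suc N) g≡0 = cong₂ _+_ (sumBelow-zeros N (λ x x<N → g≡0 x (m<n⇒m<1+n x<N))) (g≡0 N ≤-refl)

sumBelow-mono : ∀ {g M N} → M ≤ N → sumBelow M g ≤ sumBelow N g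
sumBelow-mono {N = zero}  z≤n   = ≤-refl
sumBelow-mono {N = suc N} M≤1+N with m≤n⇒m<n∨m≡n M≤1+N
... | inj₁ M<1+N = ≤-trans (sumBelow-mono (s≤s⁻¹ M<1+N)) (m≤m+n _ _)
... | inj₂ refl  = ≤-refl

sumBelow-indicators : ∀ {g} k N → (∀ x → g x ≤ 1) → (∀ x → x < k → g x ≡ 0) → sumBelow (k + N) g ≤ N
sumBelow-indicators {g} k zero _ g≡0 =
  ≤-reflexive (trans (cong (λ M → sumBelow M g) (+-identityʳ k)) (sumBelow-zeros k g≡0))
sumBelow-indicators {g} k (suc N) g≤1 g≡0 = subst (λ M → sumBelow M g ≤ suc N) (sym (+-suc k N))
  (≤-trans (+-mono-≤ (sumBelow-indicators k N g≤1 g≡0) (g≤1 (k + N))) (≤-reflexive (+-comm N 1)))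

sumBelow-progression : ∀ {g} s p c → (∀ m → m < c → g (s + m * suc p) ≡ 1) → c ≤ sumBelow (s + c * suc p) g
sumBelow-progression     s p zero    _    = z≤n
sumBelow-progression {g} s p (suc c) hits = begin
  suc c                                          ≡⟨ +-comm 1 c ⟩
  c + 1                                          ≤⟨ +-mono-≤ earlier (≤-reflexive (sym (hits c ≤-refl))) ⟩
  sumBelow (s + c * suc p) g + g (s + c * suc p) ≤⟨ sumBelow-mono next≤ ⟩
  sumBelow (s + suc c * suc p) g                 ∎
  where
  open ≤-Reasoning
  earlier : c ≤ sumBelow (s + c * suc p) g
  earlier = sumBelow-progression s p c (λ m m<c → hits m (m<n⇒m<1+n m<c))
  next≤ : suc (s + c * suc p) ≤ s + suc c * suc p
  next≤ = subst (_≤ s + suc c * suc p) (+-suc s (c * suc p)) (+-monoʳ-≤ s (s≤s (m≤n+m (c * suc p) p)))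

sum-map-mono : ∀ {X : Set} {g h : X → ℕ} {xs} → All (λ x → g x ≤ h x) xs → sum (map g xs) ≤ sum (map h xs)
sum-map-mono []             = z≤n
sum-map-mono (gx≤hx ∷ g≤h) = +-mono-≤ gx≤hx (sum-map-mono g≤h)

sum-map-*ˡ : ∀ {X : Set} k (g : X → ℕ) xs → sum (map (λ x → k * g x) xs) ≡ k * sum (map g xs)
sum-map-*ˡ k g []       = sym (*-zeroʳ k)
sum-map-*ˡ k g (x ∷ xs) = trans (cong (k * g x +_) (sum-map-*ˡ k g xs)) (sym (*-distribˡ-+ k (g x) _))

sum-sumBelow-comm : ∀ {X : Set} (g : X → ℕ → ℕ) xs N →
                    sum (map (λ a → sumBelow N (g a)) xs) ≡ sumBelow N (λ x → sum (map (λ a → g a x) xs))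
sum-sumBelow-comm g []       N = sym (sumBelow-zeros N (λ _ _ → refl))
sum-sumBelow-comm g (a ∷ xs) N =
  trans (cong (sumBelow N (g a) +_) (sum-sumBelow-comm g xs N)) (sym (sumBelow-+ N (g a) _))

positiveRepresentative : ℕ → ℕ → ℕ
positiveRepresentative zero    p = p
positiveRepresentative (suc b) p = suc b

positiveRepresentative-pos : ∀ b p → 1 ≤ positiveRepresentative b (suc p)
positiveRepresentative-pos zero    p = s≤s z≤n
positiveRepresentative-pos (suc b) p = s≤s z≤n

positiveRepresentative-≤ : ∀ {b p} → b ≤ p → positiveRepresentative b (suc p) ≤ suc p
positiveRepresentative-≤ {zero}  _   = ≤-refl
positiveRepresentative-≤ {suc b} b≤p = m≤n⇒m≤1+n b≤p

positiveRepresentative-mod : ∀ {b p} → b ≤ p → positiveRepresentative b (suc p) % suc p ≡ b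
positiveRepresentative-mod {zero}  {p} _   = n%n≡0 (suc p)
positiveRepresentative-mod {suc b} {p} b≤p = m<n⇒m%n≡m (s≤s b≤p)

module _ {A : Set} {n : ℕ} {w : ℕ → A} {i j p : ℕ} where

  run-1≤start : IsRun n w (i , j , p) → 1 ≤ i
  run-1≤start (1≤i , _) = 1≤i

  run-1≤period : IsRun n w (i , j , p) → 1 ≤ p
  run-1≤period (_ , _ , _ , (1≤p , _) , _) = 1≤p

  run-start≤end : IsRun n w (i , j , p) → i ≤ j
  run-start≤end (_ , i≤j , _) = i≤j

  run-end≤n : IsRun n w (i , j , p) → j ≤ n
  run-end≤n (_ , _ , j≤n , _) = j≤n

  run-hasPeriod : IsRun n w (i , j , p) → HasPeriod w i j p
  run-hasPeriod (_ , _ , _ , (_ , periodic , _) , _) = periodic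

  run-period-minimal : IsRun n w (i , j , p) → ∀ e → 1 ≤ e → e < p → ¬ HasPeriod w i j e
  run-period-minimal (_ , _ , _ , (_ , _ , minimal) , _) = minimal

  run-2p≤length : IsRun n w (i , j , p) → 2 * p ≤ suc j ∸ i
  run-2p≤length (_ , _ , _ , _ , 2p≤length , _) = 2p≤length

  run-left-maximal : IsRun n w (i , j , p) → i ≡ 1 ⊎ w (i ∸ 1) ≢ w (i + p ∸ 1)
  run-left-maximal (_ , _ , _ , _ , _ , left , _) = left

  run-right-maximal : IsRun n w (i , j , p) → j ≡ n ⊎ w (suc j) ≢ w (suc j ∸ p)
  run-right-maximal (_ , _ , _ , _ , _ , _ , right) = right

*≤⇒≤/ : ∀ k m n .{{_ : NonZero n}} → k * n ≤ m → k ≤ m ℕ./ n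
*≤⇒≤/ k m n k*n≤m = subst (_≤ m ℕ./ n) (m*n/n≡m k n) (/-mono-≤ k*n≤m ≤-refl)

m≤3*[m/n∸1]*n : ∀ m n .{{_ : NonZero n}} → 2 * n ≤ m → m ≤ 3 * (m ℕ./ n ∸ 1) * n
m≤3*[m/n∸1]*n m n 2n≤m = begin
  m                      ≡⟨ m≡m%n+[m/n]*n m n ⟩
  m % n + m ℕ./ n * n    ≤⟨ +-monoˡ-≤ (m ℕ./ n * n) (<⇒≤ (m%n<n m n)) ⟩
  suc (m ℕ./ n) * n      ≤⟨ *-monoˡ-≤ n (1+k≤3*[k∸1] (*≤⇒≤/ 2 m n 2n≤m)) ⟩
  3 * (m ℕ./ n ∸ 1) * n  ∎
  where
  open ≤-Reasoning
  1+k≤3*[k∸1] : ∀ {k} → 2 ≤ k → suc k ≤ 3 * (k ∸ 1)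
  1+k≤3*[k∸1] {suc (suc k)} (s≤s (s≤s _)) = subst (3 + k ≤_) (sym (*-suc 3 k)) (+-monoʳ-≤ 3 (m≤n*m k 3))

countedRoots : ℕ × ℕ × ℕ → ℕ
countedRoots (i , j , zero)  = 0
countedRoots (i , j , suc q) = (suc j ∸ i) ℕ./ suc q ∸ 1

module Runs (w : ℕ → ℕ) (n : ℕ) where

  module Root (i j q : ℕ) where

    root : ℕ → ℕ
    root x = w (i + x % suc q)

    root-periodic : ∀ x → root (x + suc q) ≡ root x
    root-periodic x = cong (λ y → w (i + y)) ([m+n]%n≡m%n x (suc q))

    direction : Bool
    direction = directionOf (w (suc j)) (w (suc j ∸ suc q))

    open LeastRotation root q root-periodic direction public

    firstRootOffset : ℕ
    firstRootOffset = positiveRepresentative leastRotation P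

  -- x starts a copy of the Lyndon root of the run, strictly after its first position i
  LyndonRootAt : ℕ × ℕ × ℕ → ℕ → Set
  LyndonRootAt (i , j , zero)  x = ⊥
  LyndonRootAt (i , j , suc q) x = i < x × x + suc q ≤ suc j × (x ∸ i) % suc q ≡ Root.leastRotation i j q

  lyndonRoot? : ∀ r x → Dec (LyndonRootAt r x)
  lyndonRoot? (i , j , zero)  x = no λ ()
  lyndonRoot? (i , j , suc q) x =
    i <? x ×-dec (x + suc q ≤? suc j ×-dec (x ∸ i) % suc q ≟ Root.leastRotation i j q)

  module _ {i j q : ℕ} (run : IsRun n w (i , j , suc q)) where

    open Root i j q

    run-periodic-* : ∀ k z → i ≤ z → z + k * P ≤ j → w (z + k * P) ≡ w z
    run-periodic-* zero    z _   _     = cong w (+-identityʳ z)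
    run-periodic-* (suc k) z i≤z z+[1+k]P≤j = begin
      w (z + (P + k * P)) ≡⟨ cong w (x∙yz≈xz∙y z P (k * P)) ⟩
      w (z + k * P + P)   ≡⟨ sym (run-hasPeriod run (z + k * P) (≤-trans i≤z (m≤m+n z _)) z+kP+P≤j) ⟩
      w (z + k * P)       ≡⟨ run-periodic-* k z i≤z (≤-trans (m≤m+n _ P) z+kP+P≤j) ⟩
      w z                 ∎
      where
      open ≡-Reasoning
      z+kP+P≤j : z + k * P + P ≤ j
      z+kP+P≤j = subst (_≤ j) (x∙yz≈xz∙y z P (k * P)) z+[1+k]P≤j

    run≡root : ∀ x → i + x ≤ j → w (i + x) ≡ root x
    run≡root x i+x≤j = trans (cong w split) (run-periodic-* (x ℕ./ P) (i + x % P) (m≤m+n i _) (subst (_≤ j) split i+x≤j))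
      where
      split : i + x ≡ i + x % P + x ℕ./ P * P
      split = trans (cong (i +_) (m≡m%n+[m/n]*n x P)) (sym (+-assoc i (x % P) _))

    root-primitive : Primitive
    root-primitive e 0<e e<P root-shift = run-period-minimal run e 0<e e<P period-e
      where
      period-e : HasPeriod w i j e
      period-e k i≤k k+e≤j = begin
        w k                  ≡⟨ cong w (sym i+[k∸i]≡k) ⟩
        w (i + (k ∸ i))      ≡⟨ run≡root (k ∸ i) (subst (_≤ j) (sym i+[k∸i]≡k) (≤-trans (m≤m+n k e) k+e≤j)) ⟩
        root (k ∸ i)         ≡⟨ root-shift (k ∸ i) ⟩
        root (k ∸ i + e)     ≡⟨ sym (run≡root (k ∸ i + e) (subst (_≤ j) (sym shifted) k+e≤j)) ⟩
        w (i + (k ∸ i + e))  ≡⟨ cong w shifted ⟩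
        w (k + e)            ∎
        where
        open ≡-Reasoning
        i+[k∸i]≡k : i + (k ∸ i) ≡ k
        i+[k∸i]≡k = m+[n∸m]≡n i≤k
        shifted : i + (k ∸ i + e) ≡ k + e
        shifted = trans (sym (+-assoc i (k ∸ i) e)) (cong (_+ e) i+[k∸i]≡k)

    run≡rotation : ∀ x → i ≤ x → ∀ s → x + s ≤ j → w (x + s) ≡ root ((x ∸ i) % P + s)
    run≡rotation x i≤x s x+s≤j =
      trans (cong w split) (trans (run≡root (x ∸ i + s) (subst (_≤ j) split x+s≤j)) (f-modˡ (x ∸ i) s))
      where
      split : x + s ≡ i + (x ∸ i + s)
      split = trans (cong (_+ s) (sym (m+[n∸m]≡n i≤x))) (+-assoc i (x ∸ i) s)

    lyndonRoot-inside : ∀ {x} → LyndonRootAt (i , j , suc q) x → x + q ≤ j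
    lyndonRoot-inside {x} (_ , x+P≤1+j , _) = s≤s⁻¹ (subst (_≤ suc j) (+-suc x q) x+P≤1+j)

    lyndonRoot-isLyndon : ∀ {x} → LyndonRootAt (i , j , suc q) x → IsLyndon direction w x q
    lyndonRoot-isLyndon {x} ρ@(i<x , _ , x≡b) =
      IsLyndon-transport {v = root} {w} {x} {leastRotation} window (leastRotation-isLyndon root-primitive)
      where
      window : ∀ s → s ≤ q → w (x + s) ≡ root (leastRotation + s)
      window s s≤q = trans (run≡rotation x (<⇒≤ i<x) s (≤-trans (+-monoʳ-≤ x s≤q) (lyndonRoot-inside ρ)))
                           (cong (λ y → root (y + s)) x≡b)

    lyndonRoot-preceded : ∀ {x} → LyndonRootAt (i , j , suc q) x → w (x ∸ 1) ≡ w (x + q)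
    lyndonRoot-preceded {suc x} ρ@(s≤s i≤x , _) =
      trans (run-hasPeriod run x i≤x (subst (_≤ j) (sym (+-suc x q)) (lyndonRoot-inside ρ))) (cong w (+-suc x q))

    run-next-smaller : j < n → w (suc j) <[ direction ] w (suc j ∸ P)
    run-next-smaller j<n with run-right-maximal run
    ... | inj₁ refl = ⊥-elim (<-irrefl refl j<n)
    ... | inj₂ next≢ = directionOf-< next≢

    lyndonRoot-first<preceding : ∀ {x} → 0 < q → LyndonRootAt (i , j , suc q) x → w x <[ direction ] w (x ∸ 1)
    lyndonRoot-first<preceding {x} 0<q ρ =
      subst (λ z → w x <[ direction ] z) (sym (lyndonRoot-preceded ρ)) (IsLyndon⇒first<last {w = w} {a = x} 0<q (lyndonRoot-isLyndon ρ))

    -- A Lyndon factor at a root that is longer than the period would run, with the period, past the end of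
    -- the run; there its comparison of w[j+1] with w[j+1-p] contradicts the choice of direction.
    lyndonRoot-maximal : ∀ {x ℓ} → LyndonRootAt (i , j , suc q) x → P ≤ ℓ → x + ℓ ≤ n → ¬ IsLyndon direction w x ℓ
    lyndonRoot-maximal {x} {ℓ} (i<x , x+P≤1+j , _) P≤ℓ x+ℓ≤n lyndon with lyndon P (s≤s z≤n) P≤ℓ
    ... | lexLess t t<1+ℓ∸P agree lt with x + P + t ≤? j
    ...   | yes inside = <[]-irrefl direction (subst (λ z → w (x + t) <[ direction ] z) (sym periodic) lt)
      where
      periodic : w (x + t) ≡ w (x + P + t)
      periodic = trans (run-hasPeriod run (x + t) (≤-trans (<⇒≤ i<x) (m≤m+n x t)) (subst (_≤ j) (xy∙z≈xz∙y x P t) inside))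
                       (cong w (sym (xy∙z≈xz∙y x P t)))
    ...   | no  outside = [ differs-inside , differs-at-end ] (m≤n⇒m<n∨m≡n t₀≤t)
      where
      t₀ = suc j ∸ (x + P)
      x+P+t₀≡1+j : x + P + t₀ ≡ suc j
      x+P+t₀≡1+j = m+[n∸m]≡n x+P≤1+j
      x+t₀≡1+j∸P : x + t₀ ≡ suc j ∸ P
      x+t₀≡1+j∸P = sym (begin
        suc j ∸ P           ≡⟨ cong (_∸ P) (sym x+P+t₀≡1+j) ⟩
        x + P + t₀ ∸ P      ≡⟨ cong (_∸ P) (xy∙z≈xz∙y x P t₀) ⟩
        x + t₀ + P ∸ P      ≡⟨ m+n∸n≡m (x + t₀) P ⟩
        x + t₀              ∎)
        where open ≡-Reasoning
      1+j≤x+P+t : suc j ≤ x + P + t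
      1+j≤x+P+t = ≰⇒> outside
      j<n : j < n
      j<n = ≤-trans 1+j≤x+P+t (≤-trans (≤-reflexive (+-assoc x P t))
              (≤-trans (+-monoʳ-≤ x (s≤s⁻¹ (<∸⇒+< t<1+ℓ∸P))) x+ℓ≤n))
      t₀≤t : t₀ ≤ t
      t₀≤t = +-cancelˡ-≤ (x + P) t₀ t (subst (_≤ x + P + t) (sym x+P+t₀≡1+j) 1+j≤x+P+t)
      differs-inside : t₀ < t → ⊥
      differs-inside t₀<t = <[]-irrefl direction (subst (λ z → w (suc j) <[ direction ] z) letters-equal (run-next-smaller j<n))
        where
        letters-equal : w (suc j ∸ P) ≡ w (suc j)
        letters-equal = trans (cong w (sym x+t₀≡1+j∸P)) (trans (agree t₀ t₀<t) (cong w x+P+t₀≡1+j))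
      differs-at-end : t₀ ≡ t → ⊥
      differs-at-end refl = <[]-asym direction (run-next-smaller j<n)
        (subst₂ (λ y z → w y <[ direction ] w z) x+t₀≡1+j∸P x+P+t₀≡1+j lt)

    private
      c = countedRoots (i , j , suc q)
      L = suc j ∸ i

    lyndonRoots-fit : firstRootOffset + c * P ≤ L
    lyndonRoots-fit = begin
      firstRootOffset + c * P  ≤⟨ +-monoˡ-≤ (c * P) (positiveRepresentative-≤ leastRotation≤q) ⟩
      suc c * P                ≡⟨ cong (_* P) (m+[n∸m]≡n (≤-trans (s≤s z≤n) (*≤⇒≤/ 2 L P (run-2p≤length run)))) ⟩
      L ℕ./ P * P              ≤⟨ m/n*n≤m L P ⟩
      L                        ∎
      where open ≤-Reasoning

    i+L≡1+j : i + L ≡ suc j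
    i+L≡1+j = m+[n∸m]≡n (m≤n⇒m≤1+n (run-start≤end run))

    lyndonRoots-≤1+n : i + firstRootOffset + c * P ≤ suc n
    lyndonRoots-≤1+n = subst (_≤ suc n) (sym (+-assoc i firstRootOffset (c * P)))
      (≤-trans (+-monoʳ-≤ i lyndonRoots-fit) (subst (_≤ suc n) (sym i+L≡1+j) (s≤s (run-end≤n run))))

    lyndonRoot-progression : ∀ m → m < c → LyndonRootAt (i , j , suc q) (i + firstRootOffset + m * P)
    lyndonRoot-progression m m<c = i<x , x+P≤1+j , x≡b
      where
      y₀ = firstRootOffset
      x = i + y₀ + m * P
      i<x : i < x
      i<x = ≤-trans (subst (_≤ i + y₀) (+-comm i 1) (+-monoʳ-≤ i (positiveRepresentative-pos leastRotation q)))
                    (m≤m+n (i + y₀) (m * P))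
      x+P≤1+j : x + P ≤ suc j
      x+P≤1+j = begin
        i + y₀ + m * P + P    ≡⟨ regroup i y₀ (m * P) P ⟩
        i + (y₀ + suc m * P)  ≤⟨ +-monoʳ-≤ i (+-monoʳ-≤ y₀ (*-monoˡ-≤ P m<c)) ⟩
        i + (y₀ + c * P)      ≤⟨ +-monoʳ-≤ i lyndonRoots-fit ⟩
        i + L                 ≡⟨ i+L≡1+j ⟩
        suc j                 ∎
        where
        open ≤-Reasoning
        regroup : ∀ a b c d → a + b + c + d ≡ a + (b + (d + c))
        regroup = solve-∀
      x≡b : (x ∸ i) % P ≡ leastRotation
      x≡b = begin
        (i + y₀ + m * P ∸ i) % P    ≡⟨ cong (λ z → (z ∸ i) % P) (+-assoc i y₀ (m * P)) ⟩
        (i + (y₀ + m * P) ∸ i) % P  ≡⟨ cong (_% P) (m+n∸m≡n i (y₀ + m * P)) ⟩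
        (y₀ + m * P) % P            ≡⟨ [m+kn]%n≡m%n y₀ m P ⟩
        y₀ % P                      ≡⟨ positiveRepresentative-mod leastRotation≤q ⟩
        leastRotation                ∎
        where open ≡-Reasoning

  same-period-start-⊥ : ∀ {i j i′ j′ q} → IsRun n w (i , j , suc q) → IsRun n w (i′ , j′ , suc q) →
                        i < i′ → i′ + q ≤ j → ⊥
  same-period-start-⊥ {i} {j} {suc i′} {q = q} R R′ (s≤s i≤i′) 1+i′+q≤j with run-left-maximal R′
  ... | inj₁ refl     = 1+n≰n (≤-trans (run-1≤start R) i≤i′)
  ... | inj₂ before≢ = before≢ (run-hasPeriod R i′ i≤i′ (subst (_≤ j) (sym (+-suc i′ q)) 1+i′+q≤j))

  same-period-end-⊥ : ∀ {i j i′ j′ q} → IsRun n w (i , j , suc q) → IsRun n w (i′ , j′ , suc q) →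
                      j < j′ → i′ + q ≤ j → ⊥
  same-period-end-⊥ {i} {j} {i′} {j′} {q} R R′ j<j′ i′+q≤j with run-right-maximal R
  ... | inj₁ refl   = <-irrefl refl (<-≤-trans j<j′ (run-end≤n R′))
  ... | inj₂ next≢ = next≢ (sym (trans (run-hasPeriod R′ k i′≤k (subst (_≤ j′) (sym k+P≡1+j) j<j′)) (cong w k+P≡1+j)))
    where
    P = suc q
    k = suc j ∸ P
    i′+P≤1+j : i′ + P ≤ suc j
    i′+P≤1+j = subst (_≤ suc j) (sym (+-suc i′ q)) (s≤s i′+q≤j)
    k+P≡1+j : k + P ≡ suc j
    k+P≡1+j = m∸n+n≡m (≤-trans (m≤n+m P i′) i′+P≤1+j)
    i′≤k : i′ ≤ k
    i′≤k = m+n≤o⇒m≤o∸n i′ i′+P≤1+j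

  same-period-runs-coincide : ∀ {i j i′ j′ q x} → IsRun n w (i , j , suc q) → IsRun n w (i′ , j′ , suc q) →
                              i < x → i′ < x → x + q ≤ j → x + q ≤ j′ → (i , j , suc q) ≡ (i′ , j′ , suc q)
  same-period-runs-coincide {q = q} R R′ i<x i′<x x+q≤j x+q≤j′ with <-cmp _ _ | <-cmp _ _
  ... | tri< i<i′ _ _ | _             = ⊥-elim (same-period-start-⊥ R R′ i<i′ (≤-trans (+-monoˡ-≤ q (<⇒≤ i′<x)) x+q≤j))
  ... | tri> _ _ i′<i | _             = ⊥-elim (same-period-start-⊥ R′ R i′<i (≤-trans (+-monoˡ-≤ q (<⇒≤ i<x)) x+q≤j′))
  ... | tri≈ _ refl _ | tri< j<j′ _ _ = ⊥-elim (same-period-end-⊥ R R′ j<j′ (≤-trans (+-monoˡ-≤ q (<⇒≤ i′<x)) x+q≤j))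
  ... | tri≈ _ refl _ | tri> _ _ j′<j = ⊥-elim (same-period-end-⊥ R′ R j′<j (≤-trans (+-monoˡ-≤ q (<⇒≤ i<x)) x+q≤j′))
  ... | tri≈ _ refl _ | tri≈ _ refl _ = refl

  shorter-period-root-⊥ : ∀ {i j i′ j′ q q′ x} → IsRun n w (i , j , suc q) → IsRun n w (i′ , j′ , suc q′) → q < q′ →
                          LyndonRootAt (i , j , suc q) x → LyndonRootAt (i′ , j′ , suc q′) x → ⊥
  shorter-period-root-⊥ {i′ = i′} {j′} {zero} {q′} {x} R R′ 0<q′ ρ ρ′ =
    <[]-irrefl d (subst (λ z → w x <[ d ] z) (trans (lyndonRoot-preceded R ρ) (cong w (+-identityʳ x)))
                        (lyndonRoot-first<preceding R′ 0<q′ ρ′))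
    where d = Root.direction i′ j′ q′
  shorter-period-root-⊥ {q = suc q} {q′} {x} R R′ q<q′ ρ ρ′ =
    lyndonRoot-maximal R ρ q<q′ (≤-trans (lyndonRoot-inside R′ ρ′) (run-end≤n R′))
      (subst (λ d → IsLyndon d w x q′) (sym same-direction) (lyndonRoot-isLyndon R′ ρ′))
    where
    same-direction = <[]-direction-unique _ _ (lyndonRoot-first<preceding R (s≤s z≤n) ρ)
                                              (lyndonRoot-first<preceding R′ (<-trans (s≤s z≤n) q<q′) ρ′)

  lyndonRoot-unique : ∀ {r r′ x} → IsRun n w r → IsRun n w r′ → LyndonRootAt r x → LyndonRootAt r′ x → r ≡ r′
  lyndonRoot-unique {_ , _ , zero} _ _ () _
  lyndonRoot-unique {_ , _ , suc _} {_ , _ , zero} _ _ _ ()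
  lyndonRoot-unique {_ , _ , suc q} {_ , _ , suc q′} R R′ ρ ρ′ with <-cmp q q′
  ... | tri< q<q′ _ _ = ⊥-elim (shorter-period-root-⊥ R R′ q<q′ ρ ρ′)
  ... | tri> _ _ q′<q = ⊥-elim (shorter-period-root-⊥ R′ R q′<q ρ′ ρ)
  ... | tri≈ _ refl _ = same-period-runs-coincide R R′ (proj₁ ρ) (proj₁ ρ′) (lyndonRoot-inside R ρ) (lyndonRoot-inside R′ ρ′)

  rootIndicator : ℕ × ℕ × ℕ → ℕ → ℕ
  rootIndicator r x = indicator (lyndonRoot? r x)

  rootsAt : List (ℕ × ℕ × ℕ) → ℕ → ℕ
  rootsAt rs x = sum (map (λ r → rootIndicator r x) rs)

  rootsAt-none : ∀ {rs x} → All (λ r → ¬ LyndonRootAt r x) rs → rootsAt rs x ≡ 0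
  rootsAt-none []                         = refl
  rootsAt-none {r ∷ _} {x} (¬ρ ∷ ¬ρs) = cong₂ _+_ (indicator-no (lyndonRoot? r x) ¬ρ) (rootsAt-none ¬ρs)

  rootsAt≤1 : ∀ {rs} → Unique rs → All (IsRun n w) rs → ∀ x → rootsAt rs x ≤ 1
  rootsAt≤1 [] [] x = z≤n
  rootsAt≤1 {r ∷ rs} (r∉rs ∷ unique) (R ∷ runs) x with lyndonRoot? r x
  ... | yes ρ = s≤s (≤-reflexive (rootsAt-none (All.zipWith (λ { (r≢r′ , R′) ρ′ → r≢r′ (lyndonRoot-unique R R′ ρ ρ′) }) (r∉rs , runs))))
  ... | no  _ = rootsAt≤1 unique runs x

  lyndonRoot-2≤ : ∀ {r x} → IsRun n w r → LyndonRootAt r x → 2 ≤ x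
  lyndonRoot-2≤ {_ , _ , zero}  _ ()
  lyndonRoot-2≤ {_ , _ , suc _} R (i<x , _) = ≤-trans (s≤s (run-1≤start R)) i<x

  rootsAt-below-2 : ∀ {rs} → All (IsRun n w) rs → ∀ x → x < 2 → rootsAt rs x ≡ 0
  rootsAt-below-2 runs x x<2 = rootsAt-none (All.map (λ R ρ → <⇒≱ x<2 (lyndonRoot-2≤ R ρ)) runs)

  countedRoots≤roots : ∀ {r} → IsRun n w r → countedRoots r ≤ sumBelow (suc n) (rootIndicator r)
  countedRoots≤roots {i , j , zero}  _ = z≤n
  countedRoots≤roots {i , j , suc q} R =
    ≤-trans (sumBelow-progression (i + firstRootOffset) q (countedRoots (i , j , suc q)) root-at)
            (sumBelow-mono (lyndonRoots-≤1+n R))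
    where
    open Root i j q using (firstRootOffset)
    root-at : ∀ m → m < countedRoots (i , j , suc q) → rootIndicator (i , j , suc q) (i + firstRootOffset + m * suc q) ≡ 1
    root-at m m<c = indicator-yes (lyndonRoot? _ _) (lyndonRoot-progression R m m<c)

  countedRoots-sum : 1 ≤ n → ∀ {rs} → Unique rs → All (IsRun n w) rs → sum (map countedRoots rs) ≤ n ∸ 1
  countedRoots-sum 1≤n {rs} unique runs = begin
    sum (map countedRoots rs)                               ≤⟨ sum-map-mono (All.map countedRoots≤roots runs) ⟩
    sum (map (λ r → sumBelow (suc n) (rootIndicator r)) rs) ≡⟨ sum-sumBelow-comm rootIndicator rs (suc n) ⟩
    sumBelow (suc n) (rootsAt rs)                           ≡⟨ cong (λ N → sumBelow (suc N) (rootsAt rs)) (sym (m+[n∸m]≡n 1≤n)) ⟩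
    sumBelow (2 + (n ∸ 1)) (rootsAt rs)                     ≤⟨ sumBelow-indicators 2 (n ∸ 1) (rootsAt≤1 unique runs) (rootsAt-below-2 runs) ⟩
    n ∸ 1                                                   ∎
    where open ≤-Reasoning

EqualityPreserved : {A B : Set} → ℕ → (ℕ → A) → (ℕ → B) → Set
EqualityPreserved N v w = ∀ k l → k < N → l < N → v k ≡ v l → w k ≡ w l

HasPeriod-transport : ∀ {A B : Set} {N} {v : ℕ → A} {w : ℕ → B} {i j p} →
                      EqualityPreserved N v w → j < N → HasPeriod v i j p → HasPeriod w i j p
HasPeriod-transport {p = p} v⇒w j<N periodic k i≤k k+p≤j =
  v⇒w k (k + p) (≤-<-trans (≤-trans (m≤m+n k p) k+p≤j) j<N) (≤-<-trans k+p≤j j<N) (periodic k i≤k k+p≤j)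

IsRun-transport : ∀ {A B : Set} {n} {v : ℕ → A} {w : ℕ → B} →
                  EqualityPreserved (2 + n) v w → EqualityPreserved (2 + n) w v → ∀ {r} → IsRun n v r → IsRun n w r
IsRun-transport {n = n} {w = w} v⇒w w⇒v {i , j , p} (1≤i , i≤j , j≤n , (1≤p , periodic , minimal) , 2p≤length , left , right) =
  1≤i , i≤j , j≤n , (1≤p , HasPeriod-transport v⇒w j<2+n periodic , minimal′) , 2p≤length ,
  map₂ (λ before≢ eq → before≢ (w⇒v (i ∸ 1) (i + p ∸ 1) i∸1<2+n i+p∸1<2+n eq)) left ,
  map₂ (λ next≢ eq → next≢ (w⇒v (suc j) (suc j ∸ p) 1+j<2+n 1+j∸p<2+n eq)) right
  where
  j<2+n : j < 2 + n
  j<2+n = s≤s (m≤n⇒m≤1+n j≤n)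
  1+j<2+n : suc j < 2 + n
  1+j<2+n = s≤s (s≤s j≤n)
  1+j∸p<2+n : suc j ∸ p < 2 + n
  1+j∸p<2+n = ≤-<-trans (m∸n≤m (suc j) p) 1+j<2+n
  i∸1<2+n : i ∸ 1 < 2 + n
  i∸1<2+n = ≤-<-trans (m∸n≤m i 1) (≤-<-trans i≤j j<2+n)
  i+p∸1<2+n : i + p ∸ 1 < 2 + n
  i+p∸1<2+n = ≤-<-trans (m∸n≤m (i + p) 1) (≤-<-trans i+p≤1+j 1+j<2+n)
    where
    i+p≤1+j : i + p ≤ suc j
    i+p≤1+j = ≤-trans (+-monoʳ-≤ i (m≤m+n p (p + 0))) (≤-trans (+-monoʳ-≤ i 2p≤length) (≤-reflexive (m+[n∸m]≡n (m≤n⇒m≤1+n i≤j))))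
  minimal′ : ∀ e → 1 ≤ e → e < p → ¬ HasPeriod w i j e
  minimal′ e 1≤e e<p periodic-e = minimal e 1≤e e<p (HasPeriod-transport w⇒v j<2+n periodic-e)

firstWitness : ∀ {P : ℕ → Set} → (∀ l → Dec (P l)) → ∀ k → P k → ∃[ l ] l ≤ k × P l × (∀ l′ → l′ < l → ¬ P l′)
firstWitness P? zero p₀ = 0 , z≤n , p₀ , λ _ ()
firstWitness {P} P? (suc k) pₖ with P? 0
... | yes p₀ = 0 , z≤n , p₀ , λ _ ()
... | no ¬p₀ with firstWitness {λ l → P (suc l)} (λ l → P? (suc l)) k pₖ
...   | l , l≤k , pₗ , before = suc l , s≤s l≤k , pₗ , λ { zero _ → ¬p₀ ; (suc l′) l′<l → before l′ (s≤s⁻¹ l′<l) }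

module FirstOccurrence {A : Set} (w : ℕ → A) (N : ℕ) (_≟ʷ_ : ∀ k → k < N → ∀ l → l < N → Dec (w k ≡ w l)) where

  -- the alternative l ≡ k makes every k (also k ≥ N) have an occurrence
  Occurrence : ℕ → ℕ → Set
  Occurrence k l = (l < N × k < N × w l ≡ w k) ⊎ l ≡ k

  occurrence? : ∀ k l → Dec (Occurrence k l)
  occurrence? k l = sameLetter? ⊎-dec (l ≟ k)
    where
    sameLetter? : Dec (l < N × k < N × w l ≡ w k)
    sameLetter? with l <? N | k <? N
    ... | yes l<N | yes k<N = map′ (λ eq → l<N , k<N , eq) (λ (_ , _ , eq) → eq) ((l ≟ʷ l<N) k k<N)
    ... | no  l≮N | _       = no λ (l<N , _) → l≮N l<N
    ... | yes _   | no  k≮N = no λ (_ , k<N , _) → k≮N k<N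

  code : ℕ → ℕ
  code k = proj₁ (firstWitness (occurrence? k) k (inj₂ refl))

  code≤ : ∀ k → code k ≤ k
  code≤ k = proj₁ (proj₂ (firstWitness (occurrence? k) k (inj₂ refl)))

  code-letter : ∀ k → w (code k) ≡ w k
  code-letter k with proj₁ (proj₂ (proj₂ (firstWitness (occurrence? k) k (inj₂ refl))))
  ... | inj₁ (_ , _ , eq) = eq
  ... | inj₂ eq           = cong w eq

  code-first : ∀ {k l} → k < N → l < N → l < code k → w l ≢ w k
  code-first {k} {l} k<N l<N l<code eq =
    proj₂ (proj₂ (proj₂ (firstWitness (occurrence? k) k (inj₂ refl)))) l l<code (inj₁ (l<N , k<N , eq))

  code-reflects : EqualityPreserved N code w
  code-reflects k l _ _ code-eq = trans (sym (code-letter k)) (trans (cong w code-eq) (code-letter l))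

  code-preserves : EqualityPreserved N w code
  code-preserves k l k<N l<N eq with <-cmp (code k) (code l)
  ... | tri≈ _ code-eq _ = code-eq
  ... | tri< k′<l′ _ _   = ⊥-elim (code-first l<N (≤-<-trans (code≤ k) k<N) k′<l′ (trans (code-letter k) eq))
  ... | tri> _ _ l′<k′   = ⊥-elim (code-first k<N (≤-<-trans (code≤ l) l<N) l′<k′ (trans (code-letter l) (sym eq)))

¬¬-∀-below : ∀ {P : ℕ → Set} → (∀ k → ¬ ¬ P k) → ∀ N → ¬ ¬ (∀ k → k < N → P k)
¬¬-∀-below ¬¬P zero    ¬all = ¬all λ _ ()
¬¬-∀-below ¬¬P (suc N) ¬all = ¬¬-∀-below ¬¬P N λ below → ¬¬P N λ pN →
  ¬all λ k k<1+N → [ below k , (λ { refl → pN }) ] (m<1+n⇒m<n∨m≡n k<1+N)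

-- Opened only from here on: the prefix +_ makes sections such as (i +_) above ambiguous.
open import Data.Integer using (+_)

toℚᵘ-/ : ∀ a d → toℚᵘ ((+ a) / suc d) ≃ᵘ mkℚᵘ (+ a) d
toℚᵘ-/ a d = ℚ.toℚᵘ-fromℚᵘ (mkℚᵘ (+ a) d)

fraction-≤ : ∀ a b d e → a * suc e ≤ b * suc d → (+ a) / suc d ≤ℚ (+ b) / suc e
fraction-≤ a b d e a*e≤b*d = ℚ.toℚᵘ-cancel-≤
  (ℚᵘ.≤-respˡ-≃ (ℚᵘ.≃-sym (toℚᵘ-/ a d)) (ℚᵘ.≤-respʳ-≃ (ℚᵘ.≃-sym (toℚᵘ-/ b e))
    (*≤* (subst₂ ℤ._≤_ (ℤ.pos-* a (suc e)) (ℤ.pos-* b (suc d)) (+≤+ a*e≤b*d)))))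

mkℚᵘ-+ : ∀ a b → mkℚᵘ (+ a) 0 +ᵘ mkℚᵘ (+ b) 0 ≃ᵘ mkℚᵘ (+ (a + b)) 0
mkℚᵘ-+ a b = *≡* (begin
  (+ a ℤ.* + 1 ℤ.+ + b ℤ.* + 1) ℤ.* + 1 ≡⟨ ℤ.*-identityʳ _ ⟩
  + a ℤ.* + 1 ℤ.+ + b ℤ.* + 1          ≡⟨ cong₂ ℤ._+_ (ℤ.*-identityʳ (+ a)) (ℤ.*-identityʳ (+ b)) ⟩
  + a ℤ.+ + b                          ≡⟨ sym (ℤ.pos-+ a b) ⟩
  + (a + b)                            ≡⟨ sym (ℤ.*-identityʳ _) ⟩
  + (a + b) ℤ.* + 1                    ∎)
  where open ≡-Reasoning

sumℚ-map-≤ : ∀ {X : Set} (f : X → ℚ) (g : X → ℕ) xs →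
             All (λ x → f x ≤ℚ (+ g x) / 1) xs → sumℚ (map f xs) ≤ℚ (+ sum (map g xs)) / 1
sumℚ-map-≤ f g []       []             = ℚ.≤-refl
sumℚ-map-≤ f g (x ∷ xs) (fx≤gx ∷ f≤g) = ℚ.toℚᵘ-cancel-≤ (begin
  toℚᵘ (f x +ℚ sumℚ (map f xs))            ≃⟨ ℚ.toℚᵘ-homo-+ (f x) (sumℚ (map f xs)) ⟩
  toℚᵘ (f x) +ᵘ toℚᵘ (sumℚ (map f xs))     ≤⟨ ℚᵘ.+-mono-≤ (ℚ.toℚᵘ-mono-≤ fx≤gx) (ℚ.toℚᵘ-mono-≤ (sumℚ-map-≤ f g xs f≤g)) ⟩
  toℚᵘ ((+ g x) / 1) +ᵘ toℚᵘ ((+ s) / 1)  ≃⟨ ℚᵘ.+-cong (toℚᵘ-/ (g x) 0) (toℚᵘ-/ s 0) ⟩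
  mkℚᵘ (+ g x) 0 +ᵘ mkℚᵘ (+ s) 0          ≃⟨ mkℚᵘ-+ (g x) s ⟩
  mkℚᵘ (+ (g x + s)) 0                    ≃⟨ ℚᵘ.≃-sym (toℚᵘ-/ (g x + s) 0) ⟩
  toℚᵘ ((+ (g x + s)) / 1)                ∎)
  where
  open ℚᵘ.≤-Reasoning
  s = sum (map g xs)

exponent≤3*countedRoots : ∀ {A : Set} {n} {w : ℕ → A} {r} → IsRun n w r → exponent r ≤ℚ (+ (3 * countedRoots r)) / 1
exponent≤3*countedRoots {r = i , j , zero}  R = ⊥-elim (1+n≰n (run-1≤period R))
exponent≤3*countedRoots {r = i , j , suc q} R =
  fraction-≤ (suc j ∸ i) (3 * countedRoots (i , j , suc q)) q 0 (≤-trans (≤-reflexive (*-identityʳ _)) (m≤3*[m/n∸1]*n (suc j ∸ i) (suc q) (run-2p≤length R)))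

exponentSum≤-ℕ : (n : ℕ) → 1 ≤ n → (w : ℕ → ℕ) → ∀ {rs} → Unique rs → All (IsRun n w) rs →
                 sumℚ (map exponent rs) ≤ℚ (+ (3 * n ∸ 3)) / 1
exponentSum≤-ℕ n 1≤n w {rs} unique runs = ℚ.≤-trans
  (sumℚ-map-≤ exponent (λ r → 3 * countedRoots r) rs (All.map exponent≤3*countedRoots runs))
  (fraction-≤ (sum (map (λ r → 3 * countedRoots r) rs)) (3 * n ∸ 3) 0 0 (*-monoˡ-≤ 1 (begin
    sum (map (λ r → 3 * countedRoots r) rs) ≡⟨ sum-map-*ˡ 3 countedRoots rs ⟩
    3 * sum (map countedRoots rs)           ≤⟨ *-monoʳ-≤ 3 (Runs.countedRoots-sum w n 1≤n unique runs) ⟩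
    3 * (n ∸ 1)                             ≡⟨ *-distribˡ-∸ 3 n 1 ⟩
    3 * n ∸ 3                               ∎)))
  where open ≤-Reasoning

-- Equality of letters in A need not be decidable, but the goal is, so we may assume it for the letters
-- at positions < n + 2 and recode each of them as the position of its first occurrence.
theorem2 : {A : Set} (n : ℕ) → 1 ≤ n → (w : ℕ → A)
    → (rs : List (ℕ × ℕ × ℕ)) → Unique rs → All (IsRun n w) rs
    → sumℚ (map exponent rs) ≤ℚ (+ (3 * n ∸ 3)) / 1
theorem2 n 1≤n w rs unique runs =
  decidable-stable (sumℚ (map exponent rs) ℚ.≤? (+ (3 * n ∸ 3)) / 1) λ ¬bound →
    ¬¬-∀-below (λ k → ¬¬-∀-below (λ l → ¬¬-excluded-middle) N) N λ _≟ʷ_ →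
      ¬bound (bound-for-code _≟ʷ_)
  where
  N = 2 + n
  bound-for-code : (∀ k → k < N → ∀ l → l < N → Dec (w k ≡ w l)) → sumℚ (map exponent rs) ≤ℚ (+ (3 * n ∸ 3)) / 1
  bound-for-code _≟ʷ_ = exponentSum≤-ℕ n 1≤n code unique (All.map (IsRun-transport code-preserves code-reflects) runs)
    where open FirstOccurrence w N _≟ʷ_
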